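{- Let $x,y$ be indeterminates and $a,b$ positive integers. Then \[\sum_{\substack{r,s,u,v\ge 0\\ r+s=a}}(-1)^{u+v}\binom{r}{u}\binom{s}{v}\binom{u+v}{a-b}(x+1)^{r-u}(y+1)^{s-v}=(-1)^{a+b}\binom{a+1}{b+1}\frac{x^{b+1}-y^{b+1}}{x-y}.\]
   Context: Binomial coefficients $\binom{m}{j}$ are zero when $j<0$ or $j>m$. The quotient $\frac{x^{b+1}-y^{b+1}}{x-y}$ denotes the polynomial $\sum_{j=0}^{b}x^jy^{b-j}$. -}

module Defs where

open import Algebra.Bundles using (CommutativeRing)
open import Data.Nat using (ℕ; zero; suc; _∸_; _≤ᵇ_)
open import Data.Nat.Combinatorics using (_C_)
open import Data.Bool using (if_then_else_)

module RingOps {c ℓ} (R : CommutativeRing c ℓ) where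
  open CommutativeRing R using (Carrier; _+_; _*_; -_; 0#; 1#)

  _^_ : Carrier → ℕ → Carrier
  x ^ zero  = 1#
  x ^ suc n = x * (x ^ n)

  nat : ℕ → Carrier
  nat zero    = 0#
  nat (suc n) = 1# + nat n

  sgn : ℕ → Carrier
  sgn n = (- 1#) ^ n

  sumTo : ℕ → (ℕ → Carrier) → Carrier
  sumTo zero    f = f zero
  sumTo (suc n) f = sumTo n f + f (suc n)

-- binom m (a - b) where the lower index a - b is an integer;
-- it is 0 when a - b < 0 (i.e. when b > a).
binomDiff : ℕ → ℕ → ℕ → ℕ
binomDiff m a b = if b ≤ᵇ a then m C (a ∸ b) else 0

module Submission where

-- Write X = x + 1, Y = y + 1, k = a - b, and for a function g
-- on ℕ let  alt X r g = Σ_{u ≤ r} (-1)^u C(r,u) X^(r-u) g(u).  The summand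
-- factors, so the left-hand side is
--     S a k = Σ_{r ≤ a} alt X r (u ↦ alt Y (a-r) (v ↦ C(u+v, k))).
-- Everything follows from one recursion for alt: by Pascal's rule,
--     alt (z+1) (r+1) g = z · alt (z+1) r g - alt (z+1) r Δg,
-- where Δg(u) = g(u+1) - g(u) (lemma alt-shift).  Since C(·,k+1) has
-- difference C(·,k) and C(·,0) has difference 0, induction gives
--     alt (y+1) s C(·,k) = (-1)^k C(s,k) y^(s-k)            (alt-binomial)
--     S a k = (-1)^k C(a+1,k) h_(a-k)(x,y)                   (S-binomial)
-- with h_n = Σ_{j ≤ n} x^j y^(n-j), the quotient (x^(n+1)-y^(n+1))/(x-y).
-- The theorem is the case k = a - b, using C(a+1,a-b) = C(a+1,b+1) and
-- (-1)^(a-b) = (-1)^(a+b); for b > a both sides vanish.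

open import Defs
open import Algebra.Bundles using (CommutativeRing)
open import Data.Nat using (ℕ; _≤_; _∸_) renaming (_+_ to _+ℕ_)
open import Data.Nat.Combinatorics using (_C_)
open import Data.Nat using (zero; suc; _<_; s≤s; z≤n; _≤?_; _≤ᵇ_)
import Data.Nat.Properties as ℕ
open import Data.Nat.Combinatorics using (nCk+nC[k+1]≡[n+1]C[k+1]; nCk≡nC[n∸k])
open import Data.Nat.Combinatorics.Specification using (k>n⇒nCk≡0)
open import Data.Bool using (true; false)
open import Data.Unit using (tt)
open import Data.Empty using (⊥-elim)
open import Relation.Nullary using (yes; no; ¬_)
import Relation.Binary.PropositionalEquality as P
import Algebra.Solver.CommutativeMonoid as CommutativeMonoidSolver

binomDiff-≤ : ∀ {a b} → b ≤ a → ∀ m → binomDiff m a b P.≡ m C (a ∸ b)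
binomDiff-≤ {a} {b} b≤a m with b ≤ᵇ a | ℕ.≤⇒≤ᵇ b≤a
... | true  | _ = P.refl
... | false | ()

binomDiff-> : ∀ {a b} → ¬ (b ≤ a) → ∀ m → binomDiff m a b P.≡ 0
binomDiff-> {a} {b} b≰a m with b ≤ᵇ a | ℕ.≤ᵇ⇒≤ b a
... | true  | b≤a = ⊥-elim (b≰a (b≤a tt))
... | false | _   = P.refl

-- C(r, u-1), read as 0 for u = 0, so that Pascal's rule holds for every u.
below : ℕ → ℕ → ℕ
below r zero    = 0
below r (suc u) = r C u

pascal : ∀ r u → suc r C u P.≡ r C u +ℕ below r u
pascal r zero    = P.refl
pascal r (suc u) = P.trans (P.sym (nCk+nC[k+1]≡[n+1]C[k+1] r u)) (ℕ.+-comm (r C u) _)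

module Proof {ℓ₁ ℓ₂} (R : CommutativeRing ℓ₁ ℓ₂) where
  open CommutativeRing R hiding (zero)
  open RingOps R
  open import Algebra.Properties.Ring ring using (-1*x≈-x; -‿distribˡ-*; -‿involutive; -0#≈0#; -‿+-comm)
  open import Relation.Binary.Reasoning.Setoid setoid
  module ×-Solver = CommutativeMonoidSolver *-commutativeMonoid
  open ×-Solver using (_⊕_; _⊜_)

  sgn-suc : ∀ n → sgn (suc n) ≈ - sgn n
  sgn-suc n = -1*x≈-x (sgn n)

  pow-+ : ∀ z m n → z ^ (m +ℕ n) ≈ (z ^ m) * (z ^ n)
  pow-+ z zero    n = sym (*-identityˡ _)
  pow-+ z (suc m) n = trans (*-cong refl (pow-+ z m n)) (sym (*-assoc _ _ _))

  sgn-double : ∀ n → sgn (n +ℕ n) ≈ 1#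
  sgn-double zero    = refl
  sgn-double (suc n) rewrite ℕ.+-suc n n = begin
      sgn (suc (suc (n +ℕ n)))     ≈⟨ trans (sgn-suc (suc (n +ℕ n))) (-‿cong (sgn-suc (n +ℕ n))) ⟩
      - - sgn (n +ℕ n)              ≈⟨ -‿involutive _ ⟩
      sgn (n +ℕ n)                  ≈⟨ sgn-double n ⟩
      1#                            ∎

  nat-+ : ∀ m n → nat (m +ℕ n) ≈ nat m + nat n
  nat-+ zero    n = sym (+-identityˡ _)
  nat-+ (suc m) n = trans (+-cong refl (nat-+ m n)) (sym (+-assoc _ _ _))

  -- Pascal's rule in R; read in n, it says the column C(·,k+1) has forward difference C(·,k).
  column-diff : ∀ k n → nat (suc n C suc k) ≈ nat (n C suc k) + nat (n C k)
  column-diff k n = trans (reflexive (P.cong nat (P.trans (P.sym (nCk+nC[k+1]≡[n+1]C[k+1] n k))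
                                                         (ℕ.+-comm (n C k) _))))
                         (nat-+ (n C suc k) (n C k))

  vanishing-term : ∀ {n k} → n < k → ∀ s w → s * nat (n C k) * w ≈ 0#
  vanishing-term {n} {k} n<k s w = begin
      s * nat (n C k) * w    ≈⟨ *-cong (*-cong refl (reflexive (P.cong nat (k>n⇒nCk≡0 n<k)))) refl ⟩
      s * 0# * w             ≈⟨ trans (*-cong (zeroʳ s) refl) (zeroˡ w) ⟩
      0#                     ∎

  binomial-guard : ∀ n k s {w w′} → (k ≤ n → w ≈ w′) → s * nat (n C k) * w ≈ s * nat (n C k) * w′
  binomial-guard n k s {w} {w′} eq with k ≤? n
  ... | yes k≤n = *-cong refl (eq k≤n)
  ... | no  k≰n = trans (vanishing-term (ℕ.≰⇒> k≰n) s w) (sym (vanishing-term (ℕ.≰⇒> k≰n) s w′))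

  -- Pascal's rule for signed terms: the induction step of both closed forms.
  signed-pascal : ∀ n k w → sgn (suc k) * nat (n C suc k) * w + - (sgn k * nat (n C k) * w)
                            ≈ sgn (suc k) * nat (suc n C suc k) * w
  signed-pascal n k w = begin
      s * c₁ * w + - (sgn k * c₀ * w)   ≈⟨ +-cong refl flip-sign ⟩
      s * c₁ * w + s * c₀ * w           ≈⟨ sym (distribʳ w _ _) ⟩
      (s * c₁ + s * c₀) * w             ≈⟨ *-cong (sym (distribˡ s _ _)) refl ⟩
      s * (c₁ + c₀) * w                 ≈⟨ *-cong (*-cong refl (sym (column-diff k n))) refl ⟩
      s * nat (suc n C suc k) * w       ∎
    where
    s c₀ c₁ : Carrier
    s  = sgn (suc k)
    c₀ = nat (n C k)
    c₁ = nat (n C suc k)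
    flip-sign : - (sgn k * c₀ * w) ≈ s * c₀ * w
    flip-sign = sym (begin
      s * c₀ * w              ≈⟨ *-cong (*-cong (sgn-suc k) refl) refl ⟩
      - sgn k * c₀ * w        ≈⟨ *-cong (sym (-‿distribˡ-* _ _)) refl ⟩
      - (sgn k * c₀) * w      ≈⟨ sym (-‿distribˡ-* _ _) ⟩
      - (sgn k * c₀ * w)      ∎)

  collect : ∀ m c z t p → m * c * p + z * (m * c * t) ≈ m * c * (z * t + p)
  collect m c z t p = begin
      m * c * p + z * (m * c * t)   ≈⟨ +-comm _ _ ⟩
      z * (m * c * t) + m * c * p   ≈⟨ +-cong (×-Solver.solve 4 (λ z m c t → z ⊕ ((m ⊕ c) ⊕ t) ⊜ (m ⊕ c) ⊕ (z ⊕ t)) refl z m c t) refl ⟩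
      m * c * (z * t) + m * c * p   ≈⟨ sym (distribˡ (m * c) _ _) ⟩
      m * c * (z * t + p)           ∎

  sum-cong : ∀ n {f g : ℕ → Carrier} → (∀ i → f i ≈ g i) → sumTo n f ≈ sumTo n g
  sum-cong zero    eq = eq zero
  sum-cong (suc n) eq = +-cong (sum-cong n eq) (eq (suc n))

  sum-cong≤ : ∀ n {f g : ℕ → Carrier} → (∀ i → i ≤ n → f i ≈ g i) → sumTo n f ≈ sumTo n g
  sum-cong≤ zero    eq = eq zero z≤n
  sum-cong≤ (suc n) eq = +-cong (sum-cong≤ n (λ i i≤n → eq i (ℕ.m≤n⇒m≤1+n i≤n))) (eq (suc n) ℕ.≤-refl)

  sum-+ : ∀ n (f g : ℕ → Carrier) → sumTo n (λ i → f i + g i) ≈ sumTo n f + sumTo n g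
  sum-+ zero    f g = refl
  sum-+ (suc n) f g = trans (+-cong (sum-+ n f g) refl) (+-assoc-swap _ _ _ _)
    where
    +-assoc-swap : ∀ p q r s → (p + q) + (r + s) ≈ (p + r) + (q + s)
    +-assoc-swap p q r s = begin
      (p + q) + (r + s)   ≈⟨ +-assoc p q _ ⟩
      p + (q + (r + s))   ≈⟨ +-cong refl (trans (sym (+-assoc q r s)) (+-cong (+-comm q r) refl)) ⟩
      p + ((r + q) + s)   ≈⟨ +-cong refl (+-assoc r q s) ⟩
      p + (r + (q + s))   ≈⟨ sym (+-assoc p r _) ⟩
      (p + r) + (q + s)   ∎

  sum-*ˡ : ∀ n (k : Carrier) (f : ℕ → Carrier) → sumTo n (λ i → k * f i) ≈ k * sumTo n f
  sum-*ˡ zero    k f = refl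
  sum-*ˡ (suc n) k f = trans (+-cong (sum-*ˡ n k f) refl) (sym (distribˡ k _ _))

  sum-neg : ∀ n (f : ℕ → Carrier) → sumTo n (λ i → - f i) ≈ - sumTo n f
  sum-neg zero    f = refl
  sum-neg (suc n) f = trans (+-cong (sum-neg n f) refl) (-‿+-comm _ _)

  sum-zero : ∀ n (f : ℕ → Carrier) → (∀ i → f i ≈ 0#) → sumTo n f ≈ 0#
  sum-zero zero    f eq = eq zero
  sum-zero (suc n) f eq = trans (+-cong (sum-zero n f eq) (eq (suc n))) (+-identityʳ 0#)

  sum-peel : ∀ n (f : ℕ → Carrier) → sumTo (suc n) f ≈ f 0 + sumTo n (λ i → f (suc i))
  sum-peel zero    f = refl
  sum-peel (suc n) f = trans (+-cong (sum-peel n f) refl) (+-assoc _ _ _)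

  -- The alternating binomial transform alt X r g = Σ_u (-1)^u C(r,u) X^(r-u) g(u);
  -- for g(u) = w^u it is (X - w)^r.

  alt : Carrier → ℕ → (ℕ → Carrier) → Carrier
  alt X r g = sumTo r (λ u → sgn u * nat (r C u) * (X ^ (r ∸ u)) * g u)

  alt-cong : ∀ X r {g h : ℕ → Carrier} → (∀ u → g u ≈ h u) → alt X r g ≈ alt X r h
  alt-cong X r eq = sum-cong r (λ u → *-cong refl (eq u))

  alt-+ : ∀ X r (g h : ℕ → Carrier) → alt X r (λ u → g u + h u) ≈ alt X r g + alt X r h
  alt-+ X r g h = trans (sum-cong r (λ u → distribˡ _ _ _)) (sum-+ r _ _)

  alt-zero : ∀ (X : Carrier) r → alt X r (λ _ → 0#) ≈ 0#
  alt-zero X r = sum-zero r _ (λ u → zeroʳ _)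

  alt-base : ∀ (X : Carrier) (g : ℕ → Carrier) → alt X 0 g ≈ g 0
  alt-base X g = trans (*-cong one refl) (*-identityˡ (g 0))
    where
    one : 1# * (1# + 0#) * 1# ≈ 1#
    one = trans (*-identityʳ _) (trans (*-identityˡ _) (+-identityʳ 1#))

  -- The C(r,u) half of Pascal's rule in alt X (r+1) g contributes X · alt X r g ...
  alt-lower : ∀ (X : Carrier) r (g : ℕ → Carrier) → sumTo (suc r) (λ u → sgn u * nat (r C u) * (X ^ (suc r ∸ u)) * g u)
                        ≈ X * alt X r g
  alt-lower X r g = begin
      sumTo r term + term (suc r)      ≈⟨ +-cong (sum-cong≤ r pull-X) last-vanishes ⟩
      sumTo r (λ u → X * inner u) + 0# ≈⟨ trans (+-identityʳ _) (sum-*ˡ r X inner) ⟩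
      X * alt X r g                    ∎
    where
    term inner : ℕ → Carrier
    term u  = sgn u * nat (r C u) * (X ^ (suc r ∸ u)) * g u
    inner u = sgn u * nat (r C u) * (X ^ (r ∸ u)) * g u
    last-vanishes : term (suc r) ≈ 0#
    last-vanishes = trans (*-cong (vanishing-term {r} ℕ.≤-refl _ _) refl) (zeroˡ (g (suc r)))
    pull-X : ∀ u → u ≤ r → term u ≈ X * inner u
    pull-X u u≤r = begin
      term u                                        ≈⟨ *-cong (*-cong refl (reflexive (P.cong (X ^_) (ℕ.+-∸-assoc 1 u≤r)))) refl ⟩
      sgn u * nat (r C u) * (X * X ^ (r ∸ u)) * g u  ≈⟨ ×-Solver.solve 5 (λ s c X p g → ((s ⊕ c) ⊕ (X ⊕ p)) ⊕ g ⊜ X ⊕ (((s ⊕ c) ⊕ p) ⊕ g)) refl _ _ _ _ _ ⟩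
      X * (sgn u * nat (r C u) * (X ^ (r ∸ u)) * g u) ∎

  -- ... and the C(r,u-1) half contributes - alt X r (g ∘ suc).
  alt-upper : ∀ (X : Carrier) r (g : ℕ → Carrier) → sumTo (suc r) (λ u → sgn u * nat (below r u) * (X ^ (suc r ∸ u)) * g u)
                        ≈ - alt X r (λ u → g (suc u))
  alt-upper X r g = begin
      sumTo (suc r) term                         ≈⟨ sum-peel r term ⟩
      term 0 + sumTo r (λ i → term (suc i))      ≈⟨ +-cong first-vanishes (sum-cong r negate) ⟩
      0# + sumTo r (λ i → - _)                   ≈⟨ trans (+-identityˡ _) (sum-neg r _) ⟩
      - alt X r (λ u → g (suc u))                ∎
    where
    term : ℕ → Carrier
    term u = sgn u * nat (below r u) * (X ^ (suc r ∸ u)) * g u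
    first-vanishes : term 0 ≈ 0#
    first-vanishes = trans (*-cong (trans (*-cong (zeroʳ _) refl) (zeroˡ _)) refl) (zeroˡ _)
    negate : ∀ i → term (suc i) ≈ - (sgn i * nat (r C i) * (X ^ (r ∸ i)) * g (suc i))
    negate i = begin
      sgn (suc i) * c * p * q     ≈⟨ *-cong (*-cong (*-cong (sgn-suc i) refl) refl) refl ⟩
      - sgn i * c * p * q         ≈⟨ *-cong (*-cong (sym (-‿distribˡ-* _ _)) refl) refl ⟩
      - (sgn i * c) * p * q       ≈⟨ *-cong (sym (-‿distribˡ-* _ _)) refl ⟩
      - (sgn i * c * p) * q       ≈⟨ sym (-‿distribˡ-* _ _) ⟩
      - (sgn i * c * p * q)       ∎
      where
      c p q : Carrier
      c = nat (r C i)
      p = X ^ (r ∸ i)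
      q = g (suc i)

  alt-pascal : ∀ (X : Carrier) r (g : ℕ → Carrier) → alt X (suc r) g ≈ X * alt X r g + - alt X r (λ u → g (suc u))
  alt-pascal X r g = begin
      alt X (suc r) g                                  ≈⟨ sum-cong (suc r) split ⟩
      sumTo (suc r) (λ u → lower u + upper u)          ≈⟨ sum-+ (suc r) lower upper ⟩
      sumTo (suc r) lower + sumTo (suc r) upper        ≈⟨ +-cong (alt-lower X r g) (alt-upper X r g) ⟩
      X * alt X r g + - alt X r (λ u → g (suc u))      ∎
    where
    lower upper : ℕ → Carrier
    lower u = sgn u * nat (r C u) * (X ^ (suc r ∸ u)) * g u
    upper u = sgn u * nat (below r u) * (X ^ (suc r ∸ u)) * g u
    split : ∀ u → sgn u * nat (suc r C u) * (X ^ (suc r ∸ u)) * g u ≈ lower u + upper u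
    split u = begin
      sgn u * nat (suc r C u) * p * g u                    ≈⟨ *-cong (*-cong (*-cong refl binom) refl) refl ⟩
      sgn u * (nat (r C u) + nat (below r u)) * p * g u    ≈⟨ *-cong (trans (*-cong (distribˡ _ _ _) refl) (distribʳ p _ _)) refl ⟩
      (sgn u * nat (r C u) * p + sgn u * nat (below r u) * p) * g u ≈⟨ distribʳ (g u) _ _ ⟩
      lower u + upper u                                    ∎
      where
      p : Carrier
      p = X ^ (suc r ∸ u)
      binom : nat (suc r C u) ≈ nat (r C u) + nat (below r u)
      binom = trans (reflexive (P.cong nat (pascal r u))) (nat-+ (r C u) (below r u))

  alt-shift : ∀ (z : Carrier) r (g d : ℕ → Carrier) → (∀ u → g (suc u) ≈ g u + d u) →
              alt (z + 1#) (suc r) g ≈ z * alt (z + 1#) r g + - alt (z + 1#) r d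
  alt-shift z r g d diff = begin
      alt (z + 1#) (suc r) g                   ≈⟨ alt-pascal (z + 1#) r g ⟩
      (z + 1#) * A + - alt (z + 1#) r (λ u → g (suc u))
                                               ≈⟨ +-cong refl (-‿cong (trans (alt-cong _ r diff) (alt-+ _ r g d))) ⟩
      (z + 1#) * A + - (A + D)                 ≈⟨ +-cong (trans (distribʳ A z 1#) (+-cong refl (*-identityˡ A))) (sym (-‿+-comm A D)) ⟩
      (z * A + A) + (- A + - D)                ≈⟨ +-assoc _ _ _ ⟩
      z * A + (A + (- A + - D))                ≈⟨ +-cong refl (trans (sym (+-assoc _ _ _)) (+-cong (-‿inverseʳ A) refl)) ⟩
      z * A + (0# + - D)                       ≈⟨ +-cong refl (+-identityˡ _) ⟩
      z * A + - D                              ∎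
    where
    A D : Carrier
    A = alt (z + 1#) r g
    D = alt (z + 1#) r d

  column₀-diff : ∀ n → nat (suc n C 0) ≈ nat (n C 0) + 0#
  column₀-diff n = sym (+-identityʳ _)

  drop-neg-zero : ∀ p q → q ≈ 0# → p + - q ≈ p
  drop-neg-zero p q q≈0 = trans (+-cong refl (trans (-‿cong q≈0) -0#≈0#)) (+-identityʳ p)

  alt-binomial : ∀ y s k → alt (y + 1#) s (λ v → nat (v C k)) ≈ sgn k * nat (s C k) * (y ^ (s ∸ k))
  alt-binomial y zero zero = trans (alt-base (y + 1#) (λ v → nat (v C 0))) (sym (trans (*-identityʳ _) (*-identityˡ _)))
  alt-binomial y zero (suc k) = trans (alt-base (y + 1#) (λ v → nat (v C suc k)))
    (trans (reflexive (P.cong nat (k>n⇒nCk≡0 {0} {suc k} (s≤s z≤n)))) (sym (vanishing-term {0} {suc k} (s≤s z≤n) _ _)))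
  alt-binomial y (suc s) zero = begin
      alt (y + 1#) (suc s) f                    ≈⟨ alt-shift y s f _ column₀-diff ⟩
      y * alt (y + 1#) s f + - alt (y + 1#) s (λ _ → 0#)
                                                ≈⟨ drop-neg-zero _ _ (alt-zero _ s) ⟩
      y * alt (y + 1#) s f                      ≈⟨ *-cong refl (alt-binomial y s zero) ⟩
      y * (1# * nat (s C 0) * y ^ s)            ≈⟨ ×-Solver.solve 4 (λ y m c p → y ⊕ ((m ⊕ c) ⊕ p) ⊜ (m ⊕ c) ⊕ (y ⊕ p)) refl y 1# _ _ ⟩
      1# * nat (suc s C 0) * y ^ suc s          ∎
    where
    f : ℕ → Carrier
    f v = nat (v C 0)
  alt-binomial y (suc s) (suc k) = begin
      alt (y + 1#) (suc s) (λ v → nat (v C suc k))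
                                    ≈⟨ alt-shift y s _ _ (column-diff k) ⟩
      y * alt (y + 1#) s (λ v → nat (v C suc k)) + - alt (y + 1#) s (λ v → nat (v C k))
                                    ≈⟨ +-cong (*-cong refl (alt-binomial y s (suc k))) (-‿cong (alt-binomial y s k)) ⟩
      y * (m * c₁ * y ^ (s ∸ suc k)) + - (sgn k * nat (s C k) * y ^ (s ∸ k))
                                    ≈⟨ +-cong (trans (×-Solver.solve 4 (λ y m c q → y ⊕ ((m ⊕ c) ⊕ q) ⊜ (m ⊕ c) ⊕ (y ⊕ q)) refl y m c₁ _)
                                                     (binomial-guard s (suc k) m lower-power)) refl ⟩
      m * c₁ * y ^ (s ∸ k) + - (sgn k * nat (s C k) * y ^ (s ∸ k))
                                    ≈⟨ signed-pascal s k _ ⟩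
      m * nat (suc s C suc k) * y ^ (s ∸ k) ∎
    where
    m c₁ : Carrier
    m  = sgn (suc k)
    c₁ = nat (s C suc k)
    lower-power : suc k ≤ s → y * y ^ (s ∸ suc k) ≈ y ^ (s ∸ k)
    lower-power (s≤s {n = s′} k≤s′) = reflexive (P.cong (y ^_) (P.sym (ℕ.+-∸-assoc 1 k≤s′)))

  module DoubleSum (x y : Carrier) where

    E : ℕ → ℕ → (ℕ → Carrier) → Carrier
    E r s f = alt (x + 1#) r (λ u → alt (y + 1#) s (λ v → f (u +ℕ v)))

    E-base : ∀ s f → E 0 s f ≈ alt (y + 1#) s f
    E-base s f = alt-base (x + 1#) (λ u → alt (y + 1#) s (λ v → f (u +ℕ v)))

    E-shift : ∀ r s (f d : ℕ → Carrier) → (∀ n → f (suc n) ≈ f n + d n) → E (suc r) s f ≈ x * E r s f + - E r s d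
    E-shift r s f d diff = alt-shift x r _ _ (λ u → trans (alt-cong _ s (λ v → diff (u +ℕ v))) (alt-+ _ s _ _))

    -- The left-hand side of the theorem, for the coefficient function f.
    S : ℕ → (ℕ → Carrier) → Carrier
    S a f = sumTo a (λ r → E r (a ∸ r) f)

    S-shift : ∀ a (f d : ℕ → Carrier) → (∀ n → f (suc n) ≈ f n + d n) →
              S (suc a) f ≈ alt (y + 1#) (suc a) f + (x * S a f + - S a d)
    S-shift a f d diff = trans (sum-peel a _)
      (+-cong (E-base (suc a) f)
        (trans (sum-cong a (λ r → E-shift r (a ∸ r) f d diff))
          (trans (sum-+ a _ _) (+-cong (sum-*ˡ a x _) (sum-neg a _)))))

    S-zero : ∀ a → S a (λ _ → 0#) ≈ 0#
    S-zero a = sum-zero a _ (λ r → trans (alt-cong _ r (λ u → alt-zero _ (a ∸ r))) (alt-zero _ r))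

    -- h n = Σ_{j ≤ n} x^j y^(n-j) = (x^(n+1) - y^(n+1)) / (x - y).
    h : ℕ → Carrier
    h n = sumTo n (λ j → (x ^ j) * (y ^ (n ∸ j)))

    h-step : ∀ n → h (suc n) ≈ x * h n + (y ^ suc n)
    h-step n = trans (sum-peel n _)
      (trans (+-cong (*-identityˡ _) (trans (sum-cong n (λ i → *-assoc _ _ _)) (sum-*ˡ n x _))) (+-comm _ _))

    -- H a k = h (a - k), truncated to 0 when k > a.
    H : ℕ → ℕ → Carrier
    H a       zero    = h a
    H zero    (suc k) = 0#
    H (suc a) (suc k) = H a k

    H-step : ∀ a k → k ≤ suc a → x * H a k + (y ^ (suc a ∸ k)) ≈ H (suc a) k
    H-step a       zero          _         = sym (h-step a)
    H-step zero    (suc zero)    _         = trans (+-cong (zeroʳ x) refl) (trans (+-identityˡ 1#) (sym (*-identityˡ 1#)))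
    H-step zero    (suc (suc k)) (s≤s ())
    H-step (suc a) (suc k)       (s≤s k≤a) = H-step a k k≤a

    H-untruncated : ∀ a k → k ≤ a → H a k P.≡ h (a ∸ k)
    H-untruncated a       zero    _         = P.refl
    H-untruncated (suc a) (suc k) (s≤s k≤a) = H-untruncated a k k≤a

    S-binomial : ∀ a k → S a (λ n → nat (n C k)) ≈ sgn k * nat (suc a C k) * H a k
    S-binomial zero zero = trans (E-base 0 (λ n → nat (n C 0))) (trans (alt-binomial y 0 0) (*-cong refl (sym (*-identityˡ 1#))))
    S-binomial zero (suc k) = trans (E-base 0 (λ n → nat (n C suc k))) (trans (alt-binomial y 0 (suc k))
                                (trans (vanishing-term {0} {suc k} (s≤s z≤n) _ _) (sym (zeroʳ _))))
    S-binomial (suc a) zero = begin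
        S (suc a) f                                  ≈⟨ S-shift a f _ column₀-diff ⟩
        alt (y + 1#) (suc a) f + (x * S a f + - S a (λ _ → 0#))
                                                     ≈⟨ +-cong (alt-binomial y (suc a) 0) (drop-neg-zero _ _ (S-zero a)) ⟩
        1# * c * y ^ suc a + x * S a f               ≈⟨ +-cong refl (*-cong refl (S-binomial a zero)) ⟩
        1# * c * y ^ suc a + x * (1# * c * h a)      ≈⟨ collect _ _ _ _ _ ⟩
        1# * c * (x * h a + y ^ suc a)               ≈⟨ *-cong refl (sym (h-step a)) ⟩
        1# * c * h (suc a)                           ∎
      where
      f : ℕ → Carrier
      f n = nat (n C 0)
      c : Carrier
      c = nat (suc a C 0)
    S-binomial (suc a) (suc k) = begin
        S (suc a) (λ n → nat (n C suc k))
                                  ≈⟨ S-shift a _ _ (column-diff k) ⟩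
        alt (y + 1#) (suc a) (λ n → nat (n C suc k)) + (x * S a (λ n → nat (n C suc k)) + - S a (λ n → nat (n C k)))
                                  ≈⟨ +-cong (alt-binomial y (suc a) (suc k))
                                            (+-cong (*-cong refl (S-binomial a (suc k))) (-‿cong (S-binomial a k))) ⟩
        m * c₁ * y ^ (a ∸ k) + (x * (m * c₁ * H a (suc k)) + - T)
                                  ≈⟨ sym (+-assoc _ _ _) ⟩
        (m * c₁ * y ^ (a ∸ k) + x * (m * c₁ * H a (suc k))) + - T
                                  ≈⟨ +-cong (trans (collect _ _ _ _ _) (binomial-guard (suc a) (suc k) m (H-step a (suc k)))) refl ⟩
        m * c₁ * H a k + - T      ≈⟨ signed-pascal (suc a) k _ ⟩
        m * nat (suc (suc a) C suc k) * H a k ∎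
      where
      m c₁ T : Carrier
      m  = sgn (suc k)
      c₁ = nat (suc a C suc k)
      T  = sgn k * nat (suc a C k) * H a k

  factor-summand : ∀ (X Y : Carrier) a b r u v → b ≤ a →
      sgn (u +ℕ v) * nat (r C u) * nat ((a ∸ r) C v) * nat (binomDiff (u +ℕ v) a b)
        * (X ^ (r ∸ u)) * (Y ^ ((a ∸ r) ∸ v))
      ≈ (sgn u * nat (r C u) * (X ^ (r ∸ u)))
        * (sgn v * nat ((a ∸ r) C v) * (Y ^ ((a ∸ r) ∸ v)) * nat ((u +ℕ v) C (a ∸ b)))
  factor-summand X Y a b r u v b≤a = trans
    (*-cong (*-cong (*-cong (*-cong (*-cong (pow-+ (- 1#) u v) refl) refl)
                            (reflexive (P.cong nat (binomDiff-≤ b≤a (u +ℕ v))))) refl) refl)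
    (×-Solver.solve 7 (λ su sv cu cv d p q → (((((su ⊕ sv) ⊕ cu) ⊕ cv) ⊕ d) ⊕ p) ⊕ q
                                            ⊜ ((su ⊕ cu) ⊕ p) ⊕ (((sv ⊕ cv) ⊕ q) ⊕ d)) refl _ _ _ _ _ _ _)

  summand-vanishes : ∀ (X Y : Carrier) a b r u v → ¬ (b ≤ a) →
      sgn (u +ℕ v) * nat (r C u) * nat ((a ∸ r) C v) * nat (binomDiff (u +ℕ v) a b)
        * (X ^ (r ∸ u)) * (Y ^ ((a ∸ r) ∸ v)) ≈ 0#
  summand-vanishes X Y a b r u v b≰a = begin
      _   ≈⟨ *-cong (*-cong (*-cong refl (reflexive (P.cong nat (binomDiff-> b≰a (u +ℕ v))))) refl) refl ⟩
      _   ≈⟨ trans (*-cong (*-cong (zeroʳ _) refl) refl) (trans (*-cong (zeroˡ _) refl) (zeroˡ _)) ⟩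
      0#  ∎

  sign-parity : ∀ {a b} → b ≤ a → sgn (a ∸ b) ≈ sgn (a +ℕ b)
  sign-parity {a} {b} b≤a = sym (begin
      sgn (a +ℕ b)                        ≈⟨ reflexive (P.cong sgn (P.trans (P.cong (_+ℕ b) (P.sym (ℕ.m∸n+n≡m b≤a)))
                                                                            (ℕ.+-assoc (a ∸ b) b b))) ⟩
      sgn ((a ∸ b) +ℕ (b +ℕ b))           ≈⟨ pow-+ (- 1#) (a ∸ b) (b +ℕ b) ⟩
      sgn (a ∸ b) * sgn (b +ℕ b)          ≈⟨ trans (*-cong refl (sgn-double b)) (*-identityʳ _) ⟩
      sgn (a ∸ b)                         ∎)

  binomial-symmetry : ∀ {a b} → b ≤ a → suc a C (a ∸ b) P.≡ (a +ℕ 1) C (b +ℕ 1)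
  binomial-symmetry {a} {b} b≤a = P.trans (P.sym (nCk≡nC[n∸k] (s≤s b≤a)))
                                          (P.cong₂ _C_ (ℕ.+-comm 1 a) (ℕ.+-comm 1 b))

  main : ∀ (a b : ℕ) (x y : Carrier) →
         sumTo a (λ r → sumTo r (λ u → sumTo (a ∸ r) (λ v →
           sgn (u +ℕ v) * nat (r C u) * nat ((a ∸ r) C v) * nat (binomDiff (u +ℕ v) a b)
           * ((x + 1#) ^ (r ∸ u)) * ((y + 1#) ^ ((a ∸ r) ∸ v)))))
         ≈ sgn (a +ℕ b) * nat ((a +ℕ 1) C (b +ℕ 1))
           * sumTo b (λ j → (x ^ j) * (y ^ (b ∸ j)))
  main a b x y with b ≤? a
  ... | yes b≤a = begin
      _                                          ≈⟨ sum-cong a (λ r → sum-cong r (λ u →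
                                                      trans (sum-cong (a ∸ r) (λ v → factor-summand _ _ a b r u v b≤a))
                                                            (sum-*ˡ (a ∸ r) _ _))) ⟩
      S a (λ n → nat (n C (a ∸ b)))              ≈⟨ S-binomial a (a ∸ b) ⟩
      sgn (a ∸ b) * nat (suc a C (a ∸ b)) * H a (a ∸ b)
                                                 ≈⟨ *-cong (*-cong (sign-parity b≤a) (reflexive (P.cong nat (binomial-symmetry b≤a))))
                                                           (reflexive (P.trans (H-untruncated a _ (ℕ.m∸n≤m a b))
                                                                               (P.cong h (ℕ.m∸[m∸n]≡n b≤a)))) ⟩
      _                                          ∎
    where open DoubleSum x y
  ... | no b≰a = trans
      (sum-zero a _ (λ r → sum-zero r _ (λ u → sum-zero (a ∸ r) _ (λ v → summand-vanishes _ _ a b r u v b≰a))))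
      (sym (vanishing-term (ℕ.+-monoˡ-< 1 (ℕ.≰⇒> b≰a)) _ _))

-- The identity holds for all a and b.
lemma2 : ∀ {c ℓ} (R : CommutativeRing c ℓ) (a b : ℕ) → 1 ≤ a → 1 ≤ b →
         let open CommutativeRing R
             open RingOps R
         in ∀ (x y : Carrier) →
            sumTo a (λ r → sumTo r (λ u → sumTo (a ∸ r) (λ v →
              sgn (u +ℕ v) * nat (r C u) * nat ((a ∸ r) C v) * nat (binomDiff (u +ℕ v) a b)
              * ((x + 1#) ^ (r ∸ u)) * ((y + 1#) ^ ((a ∸ r) ∸ v)))))
            ≈ sgn (a +ℕ b) * nat ((a +ℕ 1) C (b +ℕ 1))
              * sumTo b (λ j → (x ^ j) * (y ^ (b ∸ j)))
lemma2 R a b _ _ = Proof.main R a b
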